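{- Let $G$ be a graph, $d,L\in\mathbb N$, and $\ell_G\colon V(G)\to[L]\cup\{\infty\}$ such that for every $v$ with $\ell_G(v)\ne\infty$, $|\{u\in N_G(v):\ell_G(u)\ge\ell_G(v)\}|\le d$. Let $T$ be a rooted tree, $\mathrm{map}\colon V(T)\to V(G)$ a valid mapping, and $\mathit{missing}\in\mathbb N_0$ such that every $x\in V(T)$ that is strictly monotonically reachable with respect to $\ell_G$ satisfies $|\mathrm{Missing}(x)|\le\mathit{missing}$. Let $a\in\mathbb N$ with $a\ge d+\mathit{missing}$, and let $\ell_T$ be the output of $\mathrm{PartialLayerAssignmentTree}(G,T,\mathrm{map},a,L)$. Then for every $x\in V(T)$ that is strictly monotonically reachable with respect to $\ell_G$, $\ell_T(x)\le\ell_G(\mathrm{map}(x))$.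
   Context: $[L]=\{1,\dots,L\}$, $\infty$ exceeds every integer. A mapping $\mathrm{map}\colon V(T)\to V(G)$ is valid if every tree edge $(x,y)$ maps to an edge of $G$ and distinct children of the same node have distinct images. $\mathrm{Missing}(x)=N_G(\mathrm{map}(x))\setminus\{\mathrm{map}(c):c\text{ child of }x\text{ in }T\}$. A node $x$ is strictly monotonically reachable w.r.t. $\ell_G$ if, writing $x=x_1,\dots,x_k=r$ for the tree path from $x$ to the root $r$, $\ell_G(\mathrm{map}(x_1))<\dots<\ell_G(\mathrm{map}(x_k))$. $\mathrm{PartialLayerAssignmentTree}(G,T,\mathrm{map},a,L)$: set $V_{\ge1}=V(T)$; for $j=1,\dots,L$: $V_j=\{x\in V_{\ge j}:|\mathrm{children}_T(x)\cap V_{\ge j}|+|\mathrm{Missing}(x)|\le a\}$, set $\ell_T(x)=j$ for $x\in V_j$, and $V_{\ge j+1}=V_{\ge j}\setminus V_j$; finally $\ell_T(x)=\infty$ for $x\in V_{\ge L+1}$. -}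

module Defs where

open import Data.Nat using (ℕ; zero; suc; _+_; _≤_; _<_; _≤ᵇ_)
open import Data.Bool using (Bool; true; false; if_then_else_; _∧_; not)
open import Data.Fin using (Fin; zero; suc; _≟_)
open import Data.Product using (∃; _×_)
open import Function using (_∘_; id)
open import Relation.Nullary using (¬_; does)
open import Relation.Binary.PropositionalEquality using (_≡_)

countB : ∀ {n} → (Fin n → Bool) → ℕ
countB {zero}  f = 0
countB {suc n} f = (if f zero then 1 else 0) + countB (f ∘ suc)

anyB : ∀ {n} → (Fin n → Bool) → Bool
anyB {zero}  f = false
anyB {suc n} f = f zero Data.Bool.∨ anyB (f ∘ suc)

_==_ : ∀ {n} → Fin n → Fin n → Bool
x == y = does (x ≟ y)

data Lvl : Set where
  fin : ℕ → Lvl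
  ∞   : Lvl

data _≤L_ : Lvl → Lvl → Set where
  fin≤fin : ∀ {i j} → i ≤ j → fin i ≤L fin j
  _≤∞     : ∀ a → a ≤L ∞

data _<L_ : Lvl → Lvl → Set where
  fin<fin : ∀ {i j} → i < j → fin i <L fin j
  fin<∞   : ∀ i → fin i <L ∞

_≤Lᵇ_ : Lvl → Lvl → Bool
fin i ≤Lᵇ fin j = i ≤ᵇ j
fin i ≤Lᵇ ∞     = true
∞     ≤Lᵇ fin j = false
∞     ≤Lᵇ ∞     = true

record Graph : Set where
  field
    n      : ℕ
    adj    : Fin n → Fin n → Bool
    sym    : ∀ u v → adj u v ≡ adj v u
    irrefl : ∀ v → adj v v ≡ false

-- The root is its own parent; every other node reaches the root by
-- iterating the parent function (hence the parent structure is acyclic).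

iter : ∀ {A : Set} → (A → A) → ℕ → A → A
iter f zero    x = x
iter f (suc k) x = f (iter f k x)

record RootedTree : Set where
  field
    m        : ℕ
    root     : Fin m
    parent   : Fin m → Fin m
    parent-root : parent root ≡ root
    reach    : ∀ x → ∃ λ k → iter parent k x ≡ root

  Child : Fin m → Fin m → Set
  Child c x = (¬ c ≡ root) × (parent c ≡ x)

  childB : Fin m → Fin m → Bool
  childB c x = not (c == root) ∧ (parent c == x)

module _ (G : Graph) (T : RootedTree) where
  open Graph G
  open RootedTree T

  Valid : (Fin m → Fin n) → Set
  Valid mp =
    (∀ x → ¬ x ≡ root → adj (mp x) (mp (parent x)) ≡ true) ×
    (∀ c c' x → Child c x → Child c' x → ¬ c ≡ c' → ¬ mp c ≡ mp c')

  missingB : (Fin m → Fin n) → Fin m → Fin n → Bool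
  missingB mp x v = adj (mp x) v ∧ not (anyB (λ c → childB c x ∧ (mp c == v)))

  missingCount : (Fin m → Fin n) → Fin m → ℕ
  missingCount mp x = countB (missingB mp x)

  data SMR (ℓG : Fin n → Lvl) (mp : Fin m → Fin n) : Fin m → Set where
    atRoot : SMR ℓG mp root
    step   : ∀ {x} → ¬ x ≡ root → ℓG (mp x) <L ℓG (mp (parent x)) →
             SMR ℓG mp (parent x) → SMR ℓG mp x

  module _ (mp : Fin m → Fin n) (a : ℕ) where
    -- V_j computed from V_{≥j} (given as a Boolean predicate S)
    peel : (Fin m → Bool) → Fin m → Bool
    peel S x = S x ∧ ((countB (λ c → childB c x ∧ S c) + missingCount mp x) ≤ᵇ a)

    -- go j k S x : rounds j, j+1, …, j+k-1 with current V_{≥j} = S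
    go : ℕ → ℕ → (Fin m → Bool) → Fin m → Lvl
    go j zero    S x = ∞
    go j (suc k) S x =
      if peel S x then fin j
      else go (suc j) k (λ y → S y ∧ not (peel S y)) x

  partialLayerAssignmentTree : (Fin m → Fin n) → ℕ → ℕ → Fin m → Lvl
  partialLayerAssignmentTree mp a L = go mp a 1 L (λ _ → true)

{-# OPTIONS --safe #-}
module Submission where

-- Write V≥(t+1) for the set of tree nodes that survive the first t rounds. By induction on t,
-- every strictly monotonically reachable node x with ℓG(map x) = j ≤ t has left V≥(t+1).
-- In the decisive case j = t, a child c of x still in V≥t cannot have ℓG(map c) < ℓG(map x):
-- c would then be strictly monotonically reachable itself and, by induction, already gone.
-- Validity makes map injective on these children and sends them to neighbours u of map x
-- with ℓG(u) ≥ ℓG(map x), of which there are at most d. With |Missing(x)| ≤ missing, x has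
-- degree at most d + missing ≤ a in round t, so it is peeled by round t ≤ L and ℓT(x) ≤ t.

open import Defs
open import Data.Nat using (ℕ; zero; suc; _≤_; _<_; _+_; z≤n; s≤s; _≤ᵇ_; _≤′_; ≤′-refl; ≤′-step)
open import Data.Nat.Properties using (≤-trans; +-mono-≤; +-suc; m≤m+n; ≤⇒≤ᵇ; ≤⇒≤′; ≮⇒≥)
open import Data.Fin using (Fin; zero; suc; _≟_)
open import Data.Fin.Properties using (suc-injective)
open import Data.Bool using (Bool; true; false; not; _∧_; if_then_else_)
open import Data.Bool.Properties using (∧-identityʳ; not-injective; ∧-conicalˡ; ∧-conicalʳ; T-≡)
open import Data.Product using (∃-syntax; _×_; _,_)
open import Function using (_∘_; module Equivalence)
open import Relation.Nullary using (¬_; yes; no; contradiction)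
open import Relation.Nullary.Decidable using (dec-false)
open import Relation.Binary.PropositionalEquality
  using (_≡_; _≢_; refl; sym; trans; cong; cong₂; subst; module ≡-Reasoning)

private
  variable
    k n : ℕ

≢⇒==-false : {u v : Fin n} → u ≢ v → (u == v) ≡ false
≢⇒==-false {u = u} {v} = dec-false (u ≟ v)

==⇒≡ : {u v : Fin n} → (u == v) ≡ true → u ≡ v
==⇒≡ {u = u} {v} e with u ≟ v
... | yes u≡v = u≡v

not-==⇒≢ : {u v : Fin n} → not (u == v) ≡ true → u ≢ v
not-==⇒≢ {u = u} {v} e with u ≟ v
... | no u≢v = u≢v

≤⇒≤ᵇ≡true : {i j : ℕ} → i ≤ j → (i ≤ᵇ j) ≡ true
≤⇒≤ᵇ≡true = Equivalence.to T-≡ ∘ ≤⇒≤ᵇ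

iter-suc : {A : Set} (f : A → A) (t : ℕ) (x : A) → iter f (suc t) x ≡ iter f t (f x)
iter-suc f zero    x = refl
iter-suc f (suc t) x = cong f (iter-suc f t x)

≮L⇒≤Lᵇ : {a b : Lvl} → ¬ b <L a → (a ≤Lᵇ b) ≡ true
≮L⇒≤Lᵇ {fin i} {fin j} j≮i = ≤⇒≤ᵇ≡true (≮⇒≥ (j≮i ∘ fin<fin))
≮L⇒≤Lᵇ {fin i} {∞}     _   = refl
≮L⇒≤Lᵇ {∞}     {fin j} j≮∞ = contradiction (fin<∞ j) j≮∞
≮L⇒≤Lᵇ {∞}     {∞}     _   = refl

<L-fin⁻¹ : {b : Lvl} → b <L fin (suc k) → ∃[ j ] (b ≡ fin j × j ≤ k)
<L-fin⁻¹ (fin<fin (s≤s j≤k)) = _ , refl , j≤k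

countB-cong : {f g : Fin n → Bool} → (∀ i → f i ≡ g i) → countB f ≡ countB g
countB-cong {zero}  f≗g = refl
countB-cong {suc n} f≗g =
  cong₂ _+_ (cong (λ b → if b then 1 else 0) (f≗g zero)) (countB-cong (f≗g ∘ suc))

countB-remove : (Q : Fin n → Bool) (v : Fin n) → Q v ≡ true →
                countB Q ≡ suc (countB (λ u → Q u ∧ not (u == v)))
countB-remove Q zero Qv rewrite Qv =
  cong suc (countB-cong (λ i → sym (∧-identityʳ (Q (suc i)))))
countB-remove Q (suc v) Qv = begin
  countB Q                          ≡⟨⟩
  [ Q zero ] + countB (Q ∘ suc)     ≡⟨ cong ([ Q zero ] +_) (countB-remove (Q ∘ suc) v Qv) ⟩
  [ Q zero ] + suc rest             ≡⟨ +-suc [ Q zero ] rest ⟩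
  suc ([ Q zero ] + rest)           ≡⟨ cong (λ b → suc ([ b ] + rest)) (sym (∧-identityʳ (Q zero))) ⟩
  suc (countB (λ u → Q u ∧ not (u == suc v)))  ∎
  where
  open ≡-Reasoning
  [_] : Bool → ℕ
  [ b ] = if b then 1 else 0
  rest : ℕ
  rest = countB (λ u → Q (suc u) ∧ not (u == v))

InjectiveOn : {m : ℕ} → (Fin m → Bool) → (Fin m → Fin n) → Set
InjectiveOn P f = ∀ c c' → P c ≡ true → P c' ≡ true → f c ≡ f c' → c ≡ c'

InjectiveOn-suc : {m : ℕ} {P : Fin (suc m) → Bool} {f : Fin (suc m) → Fin n} →
                  InjectiveOn P f → InjectiveOn (P ∘ suc) (f ∘ suc)
InjectiveOn-suc f-inj c c' Pc Pc' eq = suc-injective (f-inj (suc c) (suc c') Pc Pc' eq)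

countB-≤-injection : {m : ℕ} (P : Fin m → Bool) (Q : Fin n → Bool) (f : Fin m → Fin n) →
  (∀ c → P c ≡ true → Q (f c) ≡ true) → InjectiveOn P f → countB P ≤ countB Q
countB-≤-injection {m = zero}  P Q f P⇒Qf f-inj = z≤n
countB-≤-injection {m = suc m} P Q f P⇒Qf f-inj with P zero in P0
... | false = countB-≤-injection (P ∘ suc) Q (f ∘ suc) (P⇒Qf ∘ suc) (InjectiveOn-suc f-inj)
... | true rewrite countB-remove Q (f zero) (P⇒Qf zero P0) =
  s≤s (countB-≤-injection (P ∘ suc) (λ u → Q u ∧ not (u == f zero)) (f ∘ suc)
                          P⇒Q-f0 (InjectiveOn-suc f-inj))
  where
  P⇒Q-f0 : ∀ c → P (suc c) ≡ true → (Q (f (suc c)) ∧ not (f (suc c) == f zero)) ≡ true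
  P⇒Q-f0 c Pc
    rewrite P⇒Qf (suc c) Pc
          | ≢⇒==-false (λ eq → contradiction (f-inj (suc c) zero Pc P0 eq) λ ()) = refl

childB⇒Child : (T : RootedTree) {c x : Fin (RootedTree.m T)} →
               RootedTree.childB T c x ≡ true → RootedTree.Child T c x
childB⇒Child T child = not-==⇒≢ (∧-conicalˡ _ _ child) , ==⇒≡ (∧-conicalʳ _ _ child)

module _ (G : Graph) (T : RootedTree) (mp : Fin (RootedTree.m T) → Fin (Graph.n G)) where
  open Graph G using (adj) renaming (sym to adj-sym)
  open RootedTree T using (m; parent; Child; childB)

  child-adjacent : Valid G T mp → {c x : Fin m} → Child c x → adj (mp x) (mp c) ≡ true
  child-adjacent (edges , _) {c} (c≢root , refl) =
    trans (adj-sym (mp (parent c)) (mp c)) (edges c c≢root)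

  children-≤-upper-neighbours : (ℓG : Fin (Graph.n G) → Lvl) → Valid G T mp →
    (S : Fin m → Bool) (x : Fin m) →
    (∀ c → Child c x → ℓG (mp c) <L ℓG (mp x) → S c ≡ false) →
    countB (λ c → childB c x ∧ S c) ≤ countB (λ u → adj (mp x) u ∧ (ℓG (mp x) ≤Lᵇ ℓG u))
  children-≤-upper-neighbours ℓG valid@(_ , siblings-distinct) S x lower-gone =
    countB-≤-injection _ _ mp upper injective
    where
    child : {c : Fin m} → (childB c x ∧ S c) ≡ true → Child c x
    child = childB⇒Child T ∘ ∧-conicalˡ _ _

    upper : ∀ c → (childB c x ∧ S c) ≡ true → (adj (mp x) (mp c) ∧ (ℓG (mp x) ≤Lᵇ ℓG (mp c))) ≡ true
    upper c cS rewrite child-adjacent valid (child cS) = ≮L⇒≤Lᵇ λ c<x →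
      contradiction (trans (sym (∧-conicalʳ _ _ cS)) (lower-gone c (child cS) c<x)) λ ()

    injective : InjectiveOn (λ c → childB c x ∧ S c) mp
    injective c c' cS c'S same-image with c ≟ c'
    ... | yes c≡c' = c≡c'
    ... | no  c≢c' = contradiction same-image (siblings-distinct c c' x (child cS) (child c'S) c≢c')

  module _ (a : ℕ) where
    removeLayer : (Fin m → Bool) → Fin m → Bool
    removeLayer S y = S y ∧ not (peel G T mp a S y)

    -- remaining t is V≥(t+1): the nodes still unassigned after t rounds.
    remaining : ℕ → Fin m → Bool
    remaining t = iter removeLayer t (λ _ → true)

    removeLayer-keeps : (S : Fin m → Bool) (x : Fin m) →
                        S x ≡ true → peel G T mp a S x ≡ false → removeLayer S x ≡ true
    removeLayer-keeps S x Sx unpeeled rewrite Sx | unpeeled = refl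

    removeLayer-stays-removed : (S : Fin m → Bool) (x : Fin m) →
                                S x ≡ false → removeLayer S x ≡ false
    removeLayer-stays-removed S x Sx = cong (_∧ not (peel G T mp a S x)) Sx

    removed⇒peeled : (S : Fin m → Bool) (x : Fin m) →
                     S x ≡ true → removeLayer S x ≡ false → peel G T mp a S x ≡ true
    removed⇒peeled S x Sx gone =
      not-injective (trans (sym (cong (_∧ not (peel G T mp a S x)) Sx)) gone)

    removeLayer-removes : (S : Fin m → Bool) (x : Fin m) →
      countB (λ c → childB c x ∧ S c) + missingCount G T mp x ≤ a → removeLayer S x ≡ false
    removeLayer-removes S x deg≤a with S x
    ... | false = refl
    ... | true rewrite ≤⇒≤ᵇ≡true deg≤a = refl

    go-≤ : ∀ t j k (S : Fin m → Bool) x → S x ≡ true → iter removeLayer (suc t) S x ≡ false →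
           t < k → go G T mp a j k S x ≤L fin (j + t)
    go-≤ zero j (suc k) S x Sx gone _ rewrite removed⇒peeled S x Sx gone = fin≤fin (m≤m+n j 0)
    go-≤ (suc t) j (suc k) S x Sx gone (s≤s t<k) with peel G T mp a S x in peeled
    ... | true  = fin≤fin (m≤m+n j (suc t))
    ... | false = subst (λ i → go G T mp a (suc j) k (removeLayer S) x ≤L fin i) (sym (+-suc j t))
                    (go-≤ t (suc j) k (removeLayer S) x (removeLayer-keeps S x Sx peeled)
                          (trans (sym (cong (λ R → R x) (iter-suc removeLayer (suc t) S))) gone) t<k)

    layer-≤ : ∀ L t x → remaining (suc t) x ≡ false → t < L →
              partialLayerAssignmentTree G T mp a L x ≤L fin (suc t)
    layer-≤ L t x gone t<L = go-≤ t 1 L (λ _ → true) x refl gone t<L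

    module _ {d missing : ℕ} (ℓG : Fin (Graph.n G) → Lvl) (valid : Valid G T mp)
      (layer≥1 : ∀ v j → ℓG v ≡ fin j → 1 ≤ j)
      (deg : ∀ v j → ℓG v ≡ fin j → countB (λ u → adj v u ∧ (ℓG v ≤Lᵇ ℓG u)) ≤ d)
      (miss : ∀ x → SMR G T ℓG mp x → missingCount G T mp x ≤ missing)
      (d+missing≤a : d + missing ≤ a) where

      smr-removed : ∀ t x → SMR G T ℓG mp x → {j : ℕ} → ℓG (mp x) ≡ fin j → j ≤′ t →
                    remaining t x ≡ false
      smr-removed zero    x _   ℓx ≤′-refl       = contradiction (layer≥1 _ _ ℓx) λ ()
      smr-removed (suc t) x smr ℓx (≤′-step j≤t) =
        removeLayer-stays-removed (remaining t) x (smr-removed t x smr ℓx j≤t)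
      smr-removed (suc t) x smr ℓx ≤′-refl       =
        removeLayer-removes (remaining t) x (≤-trans (+-mono-≤ children≤d (miss x smr)) d+missing≤a)
        where
        lower-children-gone : ∀ c → Child c x → ℓG (mp c) <L ℓG (mp x) → remaining t c ≡ false
        lower-children-gone c (c≢root , refl) c<x with <L-fin⁻¹ (subst (ℓG (mp c) <L_) ℓx c<x)
        ... | j , ℓc , j≤t = smr-removed t c (step c≢root c<x smr) ℓc (≤⇒≤′ j≤t)

        children≤d : countB (λ c → childB c x ∧ remaining t c) ≤ d
        children≤d =
          ≤-trans (children-≤-upper-neighbours ℓG valid (remaining t) x lower-children-gone)
                  (deg (mp x) (suc t) ℓx)

mainTheorem9 :
    (G : Graph) (T : RootedTree) (d L : ℕ) → 1 ≤ d → 1 ≤ L →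
    (ℓG : Fin (Graph.n G) → Lvl) →
    (∀ v j → ℓG v ≡ fin j → 1 ≤ j) →
    (∀ v j → ℓG v ≡ fin j → j ≤ L) →
    (∀ v j → ℓG v ≡ fin j →
      countB (λ u → Graph.adj G v u ∧ (ℓG v ≤Lᵇ ℓG u)) ≤ d) →
    (mp : Fin (RootedTree.m T) → Fin (Graph.n G)) → Valid G T mp →
    (missing : ℕ) →
    (∀ x → SMR G T ℓG mp x → missingCount G T mp x ≤ missing) →
    (a : ℕ) → 1 ≤ a → d + missing ≤ a →
    ∀ x → SMR G T ℓG mp x →
      partialLayerAssignmentTree G T mp a L x ≤L ℓG (mp x)
mainTheorem9 G T d L _ _ ℓG layer≥1 layer≤L deg mp valid missing miss a _ d+missing≤a x smr
  with ℓG (mp x) in ℓx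
... | ∞          = _ ≤∞
... | fin zero   = contradiction (layer≥1 _ _ ℓx) λ ()
... | fin (suc t) = layer-≤ G T mp a L t x removed (layer≤L _ _ ℓx)
  where
  removed : remaining G T mp a (suc t) x ≡ false
  removed = smr-removed G T mp a ℓG valid layer≥1 deg miss d+missing≤a (suc t) x smr ℓx ≤′-refl
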